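{- Let $G$ be a connected graph with infinite node set and $^{*}G$ its enlargement with respect to a free ultrafilter $\mathcal F$ on $\mathbb N$, with principal galaxy $\Gamma_0$. Let $\mathbf x$ be a hypernode in $\Gamma_0$, and $\mathbf y,\mathbf z$ hypernodes in galaxies different from $\Gamma_0$. Suppose $\mathbf x=[x_n]=[x_n']$, $\mathbf y=[y_n]=[y_n']$, $\mathbf z=[z_n]=[z_n']$ for sequences of nodes $\langle x_n\rangle,\langle x_n'\rangle,\langle y_n\rangle,\langle y_n'\rangle,\langle z_n\rangle,\langle z_n'\rangle$. If for every $m\in\mathbb N$, $\{n: d(z_n,x_n)-d(y_n,x_n)\ge m\}\in\mathcal F$, then for every $m\in\mathbb N$, $\{n: d(z_n',x_n')-d(y_n',x_n')\ge m\}\in\mathcal F$. In particular, the relation "$\Gamma_a$ is closer to $\Gamma_0$ than is $\Gamma_b$" does not depend on the representative sequences chosen.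
   Context: $G=\{X,B\}$ is a connected graph (branches are two-element subsets of $X$), $X$ infinite; $d$ is the shortest-path distance (number of branches). Hypernodes are classes $[x_n]$ of sequences of nodes modulo $\langle x_n\rangle\sim\langle y_n\rangle$ iff $\{n:x_n=y_n\}\in\mathcal F$; standard hypernodes have constant representatives. Hyperbranches are classes $[\{x_n,y_n\}]$ with $\{n:\{x_n,y_n\}\in B\}\in\mathcal F$. Hypernodes $[x_n],[y_n]$ are limitedly distant if $\{n:d(x_n,y_n)\le k\}\in\mathcal F$ for some $k\in\mathbb N$; equivalence classes are nodal galaxies, and a galaxy consists of a nodal galaxy together with all hyperbranches with both ends in it. $\Gamma_0$ is the galaxy containing the standard hypernodes. For galaxies $\Gamma_a,\Gamma_b$, $\Gamma_a$ is closer to $\Gamma_0$ than is $\Gamma_b$ if there are $\mathbf y=[y_n]$ in $\Gamma_a$, $\mathbf z=[z_n]$ in $\Gamma_b$ and $\mathbf x=[x_n]$ in $\Gamma_0$ such that for every $m\in\mathbb N$, $\{n:d(z_n,x_n)-d(y_n,x_n)\ge m\}\in\mathcal F$ (differences computed in the integers). -}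

module Defs where

open import Data.Nat using (ℕ; zero; suc; _≤_)
open import Data.Integer as ℤ using (ℤ; +_)
open import Data.List using (List)
open import Data.List.Membership.Propositional using (_∈_)
open import Data.Product using (Σ; ∃; _×_; _,_)
open import Data.Sum using (_⊎_)
open import Data.Empty using (⊥)
open import Relation.Nullary using (¬_)
open import Relation.Binary.PropositionalEquality using (_≡_)

-- Graphs: a node set and a branch relation.  A branch is a two-element
-- subset {x,y} of the node set, modelled by a symmetric irreflexive
-- adjacency relation.

record Graph : Set₁ where
  field
    Node    : Set
    Adj     : Node → Node → Set
    Adj-sym : ∀ {x y} → Adj x y → Adj y x
    Adj-irr : ∀ {x} → ¬ Adj x x

open Graph public

data Walk (G : Graph) : Node G → Node G → ℕ → Set where
  nil  : ∀ {x} → Walk G x x zero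
  cons : ∀ {x y z k} → Adj G x y → Walk G y z k → Walk G x z (suc k)

Connected : Graph → Set
Connected G = ∀ (x y : Node G) → ∃ λ k → Walk G x y k

InfiniteNodes : Graph → Set
InfiniteNodes G = ¬ (Σ (List (Node G)) λ l → ∀ (x : Node G) → x ∈ l)

IsShortestPathDistance : (G : Graph) → (Node G → Node G → ℕ) → Set
IsShortestPathDistance G d =
  ∀ (x y : Node G) → Walk G x y (d x y) × (∀ k → Walk G x y k → d x y ≤ k)

record Ultrafilter : Set₁ where
  field
    𝓕        : (ℕ → Set) → Set
    full     : 𝓕 (λ _ → ℕ)
    proper   : ¬ 𝓕 (λ _ → ⊥)
    upward   : ∀ {A B : ℕ → Set} → (∀ n → A n → B n) → 𝓕 A → 𝓕 B
    inter    : ∀ {A B : ℕ → Set} → 𝓕 A → 𝓕 B → 𝓕 (λ n → A n × B n)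
    ultra    : ∀ (A : ℕ → Set) → 𝓕 A ⊎ 𝓕 (λ n → ¬ A n)

open Ultrafilter public

Free : Ultrafilter → Set
Free U = ∀ (k : ℕ) → ¬ 𝓕 U (λ n → n ≡ k)

-- Hypernodes are classes of sequences ℕ → Node G modulo agreement on
-- a set in the ultrafilter.

SameHypernode : (G : Graph) → Ultrafilter → (ℕ → Node G) → (ℕ → Node G) → Set
SameHypernode G U x x' = 𝓕 U (λ n → x n ≡ x' n)

LimitedlyDistant : (G : Graph) → (Node G → Node G → ℕ) → Ultrafilter →
                   (ℕ → Node G) → (ℕ → Node G) → Set
LimitedlyDistant G d U x y = ∃ λ (k : ℕ) → 𝓕 U (λ n → d (x n) (y n) ≤ k)

-- The hypernode [x_n] lies in the principal galaxy Γ₀: it is limitedly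
-- distant from some standard hypernode (constant sequence).
InΓ₀ : (G : Graph) → (Node G → Node G → ℕ) → Ultrafilter → (ℕ → Node G) → Set
InΓ₀ G d U x = Σ (Node G) λ s → LimitedlyDistant G d U x (λ _ → s)

FarFrom : (G : Graph) → (Node G → Node G → ℕ) → Ultrafilter →
          (x y z : ℕ → Node G) → Set
FarFrom G d U x y z =
  ∀ (m : ℕ) → 𝓕 U (λ n → (+ m) ℤ.≤ ((+ d (z n) (x n)) ℤ.- (+ d (y n) (x n))))

-- Agreement of representatives on a set of the ultrafilter transfers any index-wise
-- condition: intersect the agreement sets with the given set and push forward by
-- upward closure.

module Submission where

open import Defs
open import Data.Nat using (ℕ)
open import Data.Integer as ℤ using (+_)
open import Data.Product using (_×_; _,_)
open import Relation.Nullary using (¬_)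
open import Relation.Binary.PropositionalEquality using (_≡_)

𝓕-cong₃ : (U : Ultrafilter) {A : Set} (P : ℕ → A → A → A → Set) {a a' b b' c c' : ℕ → A} →
          𝓕 U (λ n → a n ≡ a' n) → 𝓕 U (λ n → b n ≡ b' n) → 𝓕 U (λ n → c n ≡ c' n) →
          𝓕 U (λ n → P n (a n) (b n) (c n)) → 𝓕 U (λ n → P n (a' n) (b' n) (c' n))
𝓕-cong₃ U P {a} {a'} {b} {b'} {c} {c'} ea eb ec p =
  upward U transport (inter U ea (inter U eb (inter U ec p)))
  where
  transport : ∀ n → a n ≡ a' n × b n ≡ b' n × c n ≡ c' n × P n (a n) (b n) (c n) →
              P n (a' n) (b' n) (c' n)
  transport n (a≡ , b≡ , c≡ , h) rewrite a≡ | b≡ | c≡ = h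

farFrom-respects-SameHypernode : (G : Graph) (d : Node G → Node G → ℕ) (U : Ultrafilter)
                                 {x x' y y' z z' : ℕ → Node G} →
                                 SameHypernode G U x x' → SameHypernode G U y y' →
                                 SameHypernode G U z z' →
                                 FarFrom G d U x y z → FarFrom G d U x' y' z'
farFrom-respects-SameHypernode G d U ex ey ez far m =
  𝓕-cong₃ U (λ _ x y z → + m ℤ.≤ + d z x ℤ.- + d y x) ex ey ez (far m)

lemma4p1 : (G : Graph) → Connected G → InfiniteNodes G →
           (d : Node G → Node G → ℕ) → IsShortestPathDistance G d →
           (U : Ultrafilter) → Free U →
           (x x' y y' z z' : ℕ → Node G) →
           InΓ₀ G d U x → ¬ InΓ₀ G d U y → ¬ InΓ₀ G d U z →
           SameHypernode G U x x' → SameHypernode G U y y' →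
           SameHypernode G U z z' →
           FarFrom G d U x y z → FarFrom G d U x' y' z'
lemma4p1 G _ _ d _ U _ _ _ _ _ _ _ _ _ _ = farFrom-respects-SameHypernode G d U
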